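{- Let $p\ge2$, let $r_1,\dots,r_p\ge1$ be integers, $\mathbf r_p=(r_1,\dots,r_p)$, $|\mathbf r_p|=r_1+\cdots+r_p$, and let $n,k$ be integers with $p\leq k\leq n$ and $n\geq|\mathbf r_p|$. Then for every integer $s$ with $0\leq s\leq n-|\mathbf r_p|$, \[ {n \brace k}_{\!K(\mathbf r_p)}=\sum_{j=p}^{k}{s+j \brace k}_{\!j}{n-s \brace j}_{\!K(\mathbf r_p)}. \] In particular, taking $s=1$ (when $n\ge|\mathbf r_p|+1$), \[ {n \brace k}_{\!K(\mathbf r_p)}=k{n-1 \brace k}_{\!K(\mathbf r_p)}+{n-1 \brace k-1}_{\!K(\mathbf r_p)}, \] and taking $s=n-|\mathbf r_p|$, \[ {n \brace k}_{\!K(\mathbf r_p)}=\sum_{j=p}^{k}{n-|\mathbf r_p|+j \brace k}_{\!j}{|\mathbf r_p| \brace j}_{\!K(\mathbf r_p)}. \]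
   Context: The $r$-Stirling number ${m\brace k}_r$ is the number of partitions of $\{1,\dots,m\}$ into $k$ nonempty blocks with $1,\dots,r$ in distinct blocks. For integers $N\ge0$ and $r_1,\dots,r_p$, let $R_1,\dots,R_p$ be pairwise disjoint subsets of $\{1,\dots,N\}$ with $|R_i|=r_i$; the $K(r_1,\dots,r_p)$-Stirling number of the second kind ${N\brace k}_{K(r_1,\dots,r_p)}$ is the number of partitions of $\{1,\dots,N\}$ into $k$ nonempty blocks such that no block contains both an element of $R_i$ and an element of $R_j$ for $i\neq j$ (independent of the choice of the $R_i$; zero if $N<r_1+\cdots+r_p$). Equivalently, ${n+|\mathbf r_p|\brace k}_{K(\mathbf r_p)}$ is the number of partitions of the vertex set of $K_{r_1,\dots,r_p}\cup O_n$ (complete multipartite graph plus $n$ isolated vertices) into $k$ independent sets. -}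

module Defs where

open import Data.Bool using (Bool; true; false; _∧_; _∨_; not; if_then_else_)
open import Data.Nat using (ℕ; zero; suc; _+_; _*_; _∸_; _<ᵇ_; _≡ᵇ_)
open import Data.Fin using (Fin; toℕ)
open import Data.Maybe using (Maybe; just; nothing)
import Data.Maybe as Maybe
open import Data.List using (List; []; _∷_; [_]; map; concatMap; allFin; length; filterᵇ; upTo)
open import Data.Bool.ListAction using (all; any)
open import Data.Nat.ListAction using (sum)
open import Data.Vec using (Vec; lookup; toList)
import Data.Vec as Vec
open import Relation.Nullary using (does)
import Data.Fin as Fin

-- Set partitions of {0,…,N-1} into k nonempty blocks, encoded as
-- restricted growth strings: a labelling f : Fin N → Fin k (a vector)
-- that is surjective and such that blocks are numbered in order of
-- their least element (every label smaller than f i already occurs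
-- before position i).  This is the standard bijective encoding of set
-- partitions into exactly k (unlabelled) nonempty blocks.

labellings : (N k : ℕ) → List (Vec (Fin k) N)
labellings zero    k = [ Vec.[] ]
labellings (suc N) k = concatMap (λ v → map (λ c → c Vec.∷ v) (allFin k)) (labellings N k)

_=ᶠ_ : ∀ {k} → Fin k → Fin k → Bool
a =ᶠ b = does (a Fin.≟ b)

surjᵇ : ∀ {N k} → Vec (Fin k) N → Bool
surjᵇ {N} {k} f = all (λ c → any (λ i → lookup f i =ᶠ c) (allFin N)) (allFin k)

canonicalᵇ : ∀ {N k} → Vec (Fin k) N → Bool
canonicalᵇ {N} {k} f =
  all (λ i → all (λ c → not (toℕ c <ᵇ toℕ (lookup f i))
                        ∨ any (λ j → (toℕ j <ᵇ toℕ i) ∧ (lookup f j =ᶠ c)) (allFin N))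
                 (allFin k))
      (allFin N)

isPartitionᵇ : ∀ {N k} → Vec (Fin k) N → Bool
isPartitionᵇ f = surjᵇ f ∧ canonicalᵇ f

countPartitions : (N k : ℕ) → (∀ {N k} → Vec (Fin k) N → Bool) → ℕ
countPartitions N k P = length (filterᵇ (λ f → isPartitionᵇ f ∧ P f) (labellings N k))

-- r-Stirling numbers of the second kind:
-- partitions of {1,…,m} into k blocks with 1,…,r in distinct blocks
-- (here elements 0,…,r-1 of Fin m).  Zero when m < r.

distinctFirstᵇ : ℕ → ∀ {N k} → Vec (Fin k) N → Bool
distinctFirstᵇ r {N} f =
  all (λ x → all (λ y → not ((toℕ x <ᵇ r) ∧ (toℕ y <ᵇ r) ∧ not (toℕ x ≡ᵇ toℕ y))
                        ∨ not (lookup f x =ᶠ lookup f y))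
                 (allFin N))
      (allFin N)

rStirling : (m k r : ℕ) → ℕ
rStirling m k r = if m <ᵇ r then 0 else countPartitions m k (distinctFirstᵇ r)

-- K(r₁,…,r_p)-Stirling numbers of the second kind.
-- We take R₁ = {0,…,r₁-1}, R₂ = {r₁,…,r₁+r₂-1}, … (the number does not
-- depend on the choice of the disjoint sets R_i).

∣_∣ᵥ : ∀ {p} → Vec ℕ p → ℕ
∣ rs ∣ᵥ = sum (toList rs)

groupOf : List ℕ → ℕ → Maybe ℕ
groupOf []       x = nothing
groupOf (r ∷ rs) x = if x <ᵇ r then just 0 else Maybe.map suc (groupOf rs (x ∸ r))

differentGroupsᵇ : Maybe ℕ → Maybe ℕ → Bool
differentGroupsᵇ (just a) (just b) = not (a ≡ᵇ b)
differentGroupsᵇ _        _        = false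

respectsKᵇ : List ℕ → ∀ {N k} → Vec (Fin k) N → Bool
respectsKᵇ rs {N} f =
  all (λ x → all (λ y → not (differentGroupsᵇ (groupOf rs (toℕ x)) (groupOf rs (toℕ y)))
                        ∨ not (lookup f x =ᶠ lookup f y))
                 (allFin N))
      (allFin N)

KStirling : ∀ {p} → (N k : ℕ) → Vec ℕ p → ℕ
KStirling N k rs = if N <ᵇ ∣ rs ∣ᵥ then 0 else countPartitions N k (respectsKᵇ (toList rs))

-- Σ_{j=a}^{b} f j  (empty if b < a)
sumFromTo : ℕ → ℕ → (ℕ → ℕ) → ℕ
sumFromTo a b f = sum (map (λ i → f (a + i)) (upTo (suc b ∸ a)))

-- Both kinds of numbers count set partitions (restricted growth strings, as in
-- Defs) whose blocks separate a conflict relation A on the points: distinct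
-- points below r, resp. points of different sets R_i.  When A only involves
-- points below t, splitting off the last point of a partition of m+1 > t points
-- gives the triangular recurrence f (m+1) (k+1) = (k+1)·f m (k+1) + f m k,
-- f (m+1) 0 = 0 (avoiding-recurrence), which is the second claim.  Every table
-- obeying it satisfies f (s+m) k = Σ_{j≤k} {s+j brace k}_j · f m j
-- (stirling-convolution), by induction on s, a summation by parts and the
-- r-Stirling identity rS-shift.  The first claim follows because K-Stirling
-- numbers vanish below p blocks (pigeonhole, K-vanish); the third is s = n-|r_p|.
module Submission where

open import Defs
open import Data.Bool using (Bool; true; false; _∧_; _∨_; not; T)
open import Data.Bool.Properties using (T-∧; T-≡; T-not-≡; ∧-zeroʳ)
open import Data.Bool.ListAction using (all; any)
open import Data.Empty using (⊥-elim)
open import Data.Fin using (Fin; toℕ; inject₁; fromℕ; fromℕ<)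
import Data.Fin as Fin
open import Data.Fin.Properties
  using (toℕ-inject₁; toℕ-fromℕ; toℕ-fromℕ<; toℕ<n; inject₁ℕ<; inject₁-injective; fromℕ≢inject₁; pigeonhole)
open import Data.List using (List; []; _∷_; map; concatMap; allFin; tabulate; applyUpTo; length; filterᵇ; _++_)
import Data.List.Properties as List
import Data.List.Relation.Unary.All.Properties as All
import Data.List.Relation.Unary.Any.Properties as Any
open import Data.Maybe using (just; nothing)
open import Data.Nat
  using (ℕ; zero; suc; _+_; _*_; _∸_; _≤_; _<_; _<ᵇ_; _≡ᵇ_; z≤n; s≤s; s≤s⁻¹; z<s; s<s; _≟_; _<?_)
open import Data.Nat.Properties
open import Data.Nat.Solver using (module +-*-Solver)
import Data.Nat.ListAction as ListSum
import Data.Nat.ListAction.Properties as ListSum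
open import Data.Product using (∃; _×_; _,_; proj₁; proj₂)
open import Data.Sum using (_⊎_; inj₁; inj₂)
open import Data.Vec using (Vec; []; _∷_; lookup; _∷ʳ_; toList)
import Data.Vec as Vec
open import Data.Vec.Properties using (lookup-map)
open import Data.Vec.Relation.Unary.All using (All)
import Data.Vec.Relation.Unary.All as VecAll
open import Function using (_∘_; _⇔_; mk⇔; Equivalence)
open import Relation.Nullary using (¬_; yes; no)
open import Relation.Binary.PropositionalEquality
open import Algebra.Properties.Semiring.Sum +-*-semiring
  using (sum; sum-cong-≗; ∑-distrib-+; ∑-comm; sum-init-last; *-distribˡ-sum)

open ≡-Reasoning

sum-const : ∀ n x → sum {n} (λ _ → x) ≡ n * x
sum-const zero    x = refl
sum-const (suc n) x = cong (x +_) (sum-const n x)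

sum-zero : ∀ n {f : Fin n → ℕ} → (∀ i → f i ≡ 0) → sum f ≡ 0
sum-zero n f≗0 = trans (sum-cong-≗ {n} f≗0) (trans (sum-const n 0) (*-zeroʳ n))

-- Sums over an initial segment of ℕ: σ n f = f 0 + … + f (n - 1).
-- By definition σ (suc n) f reduces to f 0 + σ n (f ∘ suc).
σ : ℕ → (ℕ → ℕ) → ℕ
σ n f = sum {n} (f ∘ toℕ)

σ-cong : ∀ n {f g : ℕ → ℕ} → (∀ i → f i ≡ g i) → σ n f ≡ σ n g
σ-cong n f≗g = sum-cong-≗ {n} (f≗g ∘ toℕ)

σ-+ : ∀ n (f g : ℕ → ℕ) → σ n (λ i → f i + g i) ≡ σ n f + σ n g
σ-+ n f g = ∑-distrib-+ {n} (f ∘ toℕ) (g ∘ toℕ)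

σ-last : ∀ n (f : ℕ → ℕ) → σ (suc n) f ≡ σ n f + f n
σ-last n f = begin
  σ (suc n) f                                    ≡⟨ sum-init-last {n} (f ∘ toℕ) ⟩
  sum {n} (f ∘ toℕ ∘ inject₁) + f (toℕ (fromℕ n))    ≡⟨ cong₂ _+_ (sum-cong-≗ {n} (cong f ∘ toℕ-inject₁)) (cong f (toℕ-fromℕ n)) ⟩
  σ n f + f n                                    ∎

σ-zero : ∀ n (f : ℕ → ℕ) → (∀ i → i < n → f i ≡ 0) → σ n f ≡ 0
σ-zero n f f≡0 = sum-zero n (λ i → f≡0 (toℕ i) (toℕ<n i))

σ-drop : ∀ p n (f : ℕ → ℕ) → (∀ i → i < p → f i ≡ 0) → σ (p + n) f ≡ σ n (λ i → f (p + i))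
σ-drop zero    n f f<p≡0 = refl
σ-drop (suc p) n f f<p≡0 = begin
  f 0 + σ (p + n) (f ∘ suc)   ≡⟨ cong₂ _+_ (f<p≡0 0 z<s) (σ-drop p n (f ∘ suc) (λ i i<p → f<p≡0 (suc i) (s<s i<p))) ⟩
  σ n (λ i → f (suc p + i))   ∎

listSum-applyUpTo : ∀ n (f g : ℕ → ℕ) → ListSum.sum (map f (applyUpTo g n)) ≡ σ n (f ∘ g)
listSum-applyUpTo zero    f g = refl
listSum-applyUpTo (suc n) f g = cong (f (g 0) +_) (listSum-applyUpTo n f (g ∘ suc))

sumFromTo≡σ : ∀ p k (f : ℕ → ℕ) → p ≤ k → (∀ j → j < p → f j ≡ 0) → sumFromTo p k f ≡ σ (suc k) f
sumFromTo≡σ p k f p≤k f<p≡0 with m≤n⇒∃[o]m+o≡n p≤k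
... | c , refl = begin
  ListSum.sum (map (λ i → f (p + i)) (applyUpTo (λ i → i) (suc (p + c) ∸ p)))
    ≡⟨ cong (λ l → ListSum.sum (map (λ i → f (p + i)) (applyUpTo (λ i → i) l))) length≡ ⟩
  ListSum.sum (map (λ i → f (p + i)) (applyUpTo (λ i → i) (suc c)))
    ≡⟨ listSum-applyUpTo (suc c) (λ i → f (p + i)) (λ i → i) ⟩
  σ (suc c) (λ i → f (p + i))
    ≡⟨ σ-drop p (suc c) f f<p≡0 ⟨
  σ (p + suc c) f
    ≡⟨ cong (λ l → σ l f) (+-suc p c) ⟩
  σ (suc (p + c)) f ∎
  where
  length≡ : suc (p + c) ∸ p ≡ suc c
  length≡ = trans (cong (_∸ p) (sym (+-suc p c))) (m+n∸m≡n p (suc c))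

𝟙 : Bool → ℕ
𝟙 true  = 1
𝟙 false = 0

-- The sum of g over all labellings of N points by k labels; it peels off the
-- first point, mirroring the recursion of Defs.labellings.
sumLab : ∀ N k → (Vec (Fin k) N → ℕ) → ℕ
sumLab zero    k g = g []
sumLab (suc N) k g = sumLab N k (λ v → sum {k} (λ c → g (c ∷ v)))

sumLab-cong : ∀ N k {g h : Vec (Fin k) N → ℕ} → (∀ v → g v ≡ h v) → sumLab N k g ≡ sumLab N k h
sumLab-cong zero    k g≗h = g≗h []
sumLab-cong (suc N) k g≗h = sumLab-cong N k (λ v → sum-cong-≗ {k} (λ c → g≗h (c ∷ v)))

sumLab-+ : ∀ N k (g h : Vec (Fin k) N → ℕ) → sumLab N k (λ v → g v + h v) ≡ sumLab N k g + sumLab N k h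
sumLab-+ zero    k g h = refl
sumLab-+ (suc N) k g h =
  trans (sumLab-cong N k (λ v → ∑-distrib-+ {k} _ _)) (sumLab-+ N k _ _)

sumLab-* : ∀ N k a (g : Vec (Fin k) N → ℕ) → sumLab N k (λ v → a * g v) ≡ a * sumLab N k g
sumLab-* zero    k a g = refl
sumLab-* (suc N) k a g =
  trans (sumLab-cong N k (λ v → sym (*-distribˡ-sum {k} a _))) (sumLab-* N k a _)

sumLab-zero : ∀ N k (g : Vec (Fin k) N → ℕ) → (∀ v → g v ≡ 0) → sumLab N k g ≡ 0
sumLab-zero zero    k g g≗0 = g≗0 []
sumLab-zero (suc N) k g g≗0 = sumLab-zero N k _ (λ v → sum-zero k (λ c → g≗0 (c ∷ v)))

sumLab-snoc : ∀ N k (g : Vec (Fin k) (suc N) → ℕ) →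
  sumLab (suc N) k g ≡ sumLab N k (λ v → sum {k} (λ c → g (v ∷ʳ c)))
sumLab-snoc zero    k g = refl
sumLab-snoc (suc N) k g =
  trans (sumLab-snoc N k (λ v → sum {k} (λ c → g (c ∷ v))))
        (sumLab-cong N k (λ w → ∑-comm {k} {k} (λ d c → g (c ∷ (w ∷ʳ d)))))

sumLab-lift : ∀ N k (g : Vec (Fin (suc k)) N → ℕ) → (∀ v i → lookup v i ≡ fromℕ k → g v ≡ 0) →
  sumLab N (suc k) g ≡ sumLab N k (g ∘ Vec.map inject₁)
sumLab-lift zero    k g g-top≡0 = refl
sumLab-lift (suc N) k g g-top≡0 = begin
  sumLab N (suc k) (λ v → sum {suc k} (λ c → g (c ∷ v)))
    ≡⟨ sumLab-lift N k _ (λ v i v-top → sum-zero (suc k) (λ c → g-top≡0 (c ∷ v) (Fin.suc i) v-top)) ⟩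
  sumLab N k (λ w → sum {suc k} (λ c → g (c ∷ Vec.map inject₁ w)))
    ≡⟨ sumLab-cong N k drop-top ⟩
  sumLab N k (λ w → sum {k} (λ c → g (inject₁ c ∷ Vec.map inject₁ w))) ∎
  where
  drop-top : ∀ w → sum {suc k} (λ c → g (c ∷ Vec.map inject₁ w))
                 ≡ sum {k} (λ c → g (inject₁ c ∷ Vec.map inject₁ w))
  drop-top w = begin
    sum {suc k} (λ c → g (c ∷ Vec.map inject₁ w))
      ≡⟨ sum-init-last {k} (λ c → g (c ∷ Vec.map inject₁ w)) ⟩
    sum {k} (λ c → g (inject₁ c ∷ Vec.map inject₁ w)) + g (fromℕ k ∷ Vec.map inject₁ w)
      ≡⟨ cong (sum {k} (λ c → g (inject₁ c ∷ Vec.map inject₁ w)) +_) (g-top≡0 _ Fin.zero refl) ⟩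
    sum {k} (λ c → g (inject₁ c ∷ Vec.map inject₁ w)) + 0
      ≡⟨ +-identityʳ _ ⟩
    sum {k} (λ c → g (inject₁ c ∷ Vec.map inject₁ w)) ∎

length-filterᵇ : ∀ {A : Set} (q : A → Bool) xs → length (filterᵇ q xs) ≡ ListSum.sum (map (𝟙 ∘ q) xs)
length-filterᵇ q []       = refl
length-filterᵇ q (x ∷ xs) with q x
... | true  = cong suc (length-filterᵇ q xs)
... | false = length-filterᵇ q xs

listSum-concatMap : ∀ {A B : Set} (h : B → ℕ) (F : A → List B) xs →
  ListSum.sum (map h (concatMap F xs)) ≡ ListSum.sum (map (λ x → ListSum.sum (map h (F x))) xs)
listSum-concatMap h F []       = refl
listSum-concatMap h F (x ∷ xs) = begin
  ListSum.sum (map h (F x ++ concatMap F xs))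
    ≡⟨ cong ListSum.sum (List.map-++ h (F x) (concatMap F xs)) ⟩
  ListSum.sum (map h (F x) ++ map h (concatMap F xs))
    ≡⟨ ListSum.sum-++ (map h (F x)) _ ⟩
  ListSum.sum (map h (F x)) + ListSum.sum (map h (concatMap F xs))
    ≡⟨ cong (_ +_) (listSum-concatMap h F xs) ⟩
  ListSum.sum (map (λ x → ListSum.sum (map h (F x))) (x ∷ xs)) ∎

listSum-tabulate : ∀ {A : Set} n (h : A → ℕ) (f : Fin n → A) → ListSum.sum (map h (tabulate f)) ≡ sum (h ∘ f)
listSum-tabulate zero    h f = refl
listSum-tabulate (suc n) h f = cong (h (f Fin.zero) +_) (listSum-tabulate n h (f ∘ Fin.suc))

listSum-labellings : ∀ N k (h : Vec (Fin k) N → ℕ) → ListSum.sum (map h (labellings N k)) ≡ sumLab N k h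
listSum-labellings zero    k h = +-identityʳ (h [])
listSum-labellings (suc N) k h = begin
  ListSum.sum (map h (labellings (suc N) k))
    ≡⟨ listSum-concatMap h _ (labellings N k) ⟩
  ListSum.sum (map (λ v → ListSum.sum (map h (map (_∷ v) (allFin k)))) (labellings N k))
    ≡⟨ cong ListSum.sum (List.map-cong (λ v → trans (cong ListSum.sum (sym (List.map-∘ (allFin k))))
                                                     (listSum-tabulate k _ (λ c → c)))
                                       (labellings N k)) ⟩
  ListSum.sum (map (λ v → sum {k} (λ c → h (c ∷ v))) (labellings N k))
    ≡⟨ listSum-labellings N k _ ⟩
  sumLab (suc N) k h ∎

countPartitions≡sumLab : ∀ N k (P : ∀ {N k} → Vec (Fin k) N → Bool) →
  countPartitions N k P ≡ sumLab N k (λ f → 𝟙 (isPartitionᵇ f ∧ P f))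
countPartitions≡sumLab N k P = trans (length-filterᵇ _ (labellings N k)) (listSum-labellings N k _)

T-ext : ∀ {a b} → (T a → T b) → (T b → T a) → a ≡ b
T-ext {false} {false} _   _   = refl
T-ext {false} {true}  _   b⇒a = ⊥-elim (b⇒a _)
T-ext {true}  {false} a⇒b _   = ⊥-elim (a⇒b _)
T-ext {true}  {true}  _   _   = refl

T-not⁺ : ∀ {a} → T (not a) → ¬ T a
T-not⁺ {false} _ ()

T-not⁻ : ∀ {a} → ¬ T a → T (not a)
T-not⁻ {false} _  = _
T-not⁻ {true}  ¬a = ¬a _

implies⁺ : ∀ {a b} → T (not a ∨ b) → T a → T b
implies⁺ {true} b _ = b

implies⁻ : ∀ {a b} → (T a → T b) → T (not a ∨ b)
implies⁻ {false} _   = _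
implies⁻ {true}  a⇒b = a⇒b _

all-allFin⁺ : ∀ {n} (p : Fin n → Bool) → T (all p (allFin n)) → ∀ i → T (p i)
all-allFin⁺ p t = All.tabulate⁻ (All.all⁺ p (allFin _) t)

all-allFin⁻ : ∀ {n} (p : Fin n → Bool) → (∀ i → T (p i)) → T (all p (allFin n))
all-allFin⁻ p h = All.all⁻ p (All.tabulate⁺ h)

any-allFin⁺ : ∀ {n} (p : Fin n → Bool) → T (any p (allFin n)) → ∃ λ i → T (p i)
any-allFin⁺ p t = Any.tabulate⁻ (Any.any⁻ p (allFin _) t)

any-allFin⁻ : ∀ {n} (p : Fin n → Bool) i → T (p i) → T (any p (allFin n))
any-allFin⁻ p i t = Any.any⁺ p (Any.tabulate⁺ i t)

=ᶠ⇒≡ : ∀ {k} {a b : Fin k} → T (a =ᶠ b) → a ≡ b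
=ᶠ⇒≡ {a = a} {b} t with a Fin.≟ b
... | yes a≡b = a≡b

≡⇒=ᶠ : ∀ {k} {a b : Fin k} → a ≡ b → T (a =ᶠ b)
≡⇒=ᶠ {a = a} {b} a≡b with a Fin.≟ b
... | yes _   = _
... | no  a≢b = a≢b a≡b

Occurs : ∀ {N k} → Vec (Fin k) N → Fin k → Set
Occurs {N} v c = ∃ λ (i : Fin N) → lookup v i ≡ c

Surjective : ∀ {N k} → Vec (Fin k) N → Set
Surjective {k = k} v = (c : Fin k) → Occurs v c

Canonical : ∀ {N k} → Vec (Fin k) N → Set
Canonical {N} {k} v =
  (i : Fin N) (c : Fin k) → toℕ c < toℕ (lookup v i) → ∃ λ (j : Fin N) → toℕ j < toℕ i × lookup v j ≡ c

IsPartition : ∀ {N k} → Vec (Fin k) N → Set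
IsPartition v = Surjective v × Canonical v

surjᵇ⇔ : ∀ {N k} (v : Vec (Fin k) N) → T (surjᵇ v) ⇔ Surjective v
surjᵇ⇔ v = mk⇔
  (λ t c → let i , e = any-allFin⁺ _ (all-allFin⁺ _ t c) in i , =ᶠ⇒≡ e)
  (λ s → all-allFin⁻ _ (λ c → any-allFin⁻ _ (proj₁ (s c)) (≡⇒=ᶠ (proj₂ (s c)))))

canonicalᵇ⇔ : ∀ {N k} (v : Vec (Fin k) N) → T (canonicalᵇ v) ⇔ Canonical v
canonicalᵇ⇔ {N} v = mk⇔ to
  (λ cn → all-allFin⁻ _ (λ i → all-allFin⁻ _ (λ c → implies⁻ (λ lt →
    let j , j<i , e = cn i c (<ᵇ⇒< _ _ lt)
    in any-allFin⁻ _ j (Equivalence.from T-∧ (<⇒<ᵇ j<i , ≡⇒=ᶠ e))))))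
  where
  to : T (canonicalᵇ v) → Canonical v
  to t i c c<vi with any-allFin⁺ _ (implies⁺ (all-allFin⁺ _ (all-allFin⁺ _ t i) c) (<⇒<ᵇ c<vi))
  ... | j , w with Equivalence.to T-∧ w
  ... | j<i , e = j , <ᵇ⇒< _ _ j<i , =ᶠ⇒≡ e

isPartitionᵇ⇔ : ∀ {N k} (v : Vec (Fin k) N) → T (isPartitionᵇ v) ⇔ IsPartition v
isPartitionᵇ⇔ v = mk⇔
  (λ t → let s , c = Equivalence.to T-∧ t
         in Equivalence.to (surjᵇ⇔ v) s , Equivalence.to (canonicalᵇ⇔ v) c)
  (λ (s , c) → Equivalence.from T-∧ (Equivalence.from (surjᵇ⇔ v) s , Equivalence.from (canonicalᵇ⇔ v) c))

data LastView {N : ℕ} : Fin (suc N) → Set where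
  earlier : (i : Fin N) → LastView (inject₁ i)
  final   : LastView (fromℕ N)

lastView : ∀ {N} (x : Fin (suc N)) → LastView x
lastView {zero}  Fin.zero    = final
lastView {suc N} Fin.zero    = earlier Fin.zero
lastView {suc N} (Fin.suc x) with lastView x
... | earlier i = earlier (Fin.suc i)
... | final     = final

lookup-∷ʳ-earlier : ∀ {A : Set} {N} (v : Vec A N) c i → lookup (v ∷ʳ c) (inject₁ i) ≡ lookup v i
lookup-∷ʳ-earlier (x ∷ v) c Fin.zero    = refl
lookup-∷ʳ-earlier (x ∷ v) c (Fin.suc i) = lookup-∷ʳ-earlier v c i

lookup-∷ʳ-final : ∀ {A : Set} {N} (v : Vec A N) c → lookup (v ∷ʳ c) (fromℕ N) ≡ c
lookup-∷ʳ-final []      c = refl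
lookup-∷ʳ-final (x ∷ v) c = lookup-∷ʳ-final v c

earlier<final : ∀ {N} (i : Fin N) → toℕ (inject₁ i) < toℕ (fromℕ N)
earlier<final {N} i = subst (toℕ (inject₁ i) <_) (sym (toℕ-fromℕ N)) (inject₁ℕ< i)

below-top : ∀ {k} (d : Fin (suc k)) → d ≡ fromℕ k ⊎ toℕ d < toℕ (fromℕ k)
below-top d with lastView d
... | earlier d′ = inj₂ (earlier<final d′)
... | final      = inj₁ refl

occurs-∷ʳ⁻ : ∀ {N k} (v : Vec (Fin k) N) c d → Occurs (v ∷ʳ c) d → Occurs v d ⊎ c ≡ d
occurs-∷ʳ⁻ v c d (x , e) with lastView x
... | earlier i = inj₁ (i , trans (sym (lookup-∷ʳ-earlier v c i)) e)
... | final     = inj₂ (trans (sym (lookup-∷ʳ-final v c)) e)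

occurs-∷ʳ⁺ : ∀ {N k} (v : Vec (Fin k) N) c d → Occurs v d → Occurs (v ∷ʳ c) d
occurs-∷ʳ⁺ v c d (i , e) = inject₁ i , trans (lookup-∷ʳ-earlier v c i) e

occurs-∷ʳ-final : ∀ {N k} (v : Vec (Fin k) N) c → Occurs (v ∷ʳ c) c
occurs-∷ʳ-final {N} v c = fromℕ N , lookup-∷ʳ-final v c

occurs-below : ∀ {N k} (v : Vec (Fin k) N) → Canonical v → ∀ {d d′} → Occurs v d → toℕ d′ < toℕ d → Occurs v d′
occurs-below v cn (i , refl) d′<d = let j , _ , e = cn i _ d′<d in j , e

surjective-from-top : ∀ {N k} (v : Vec (Fin (suc k)) N) → Canonical v → Occurs v (fromℕ k) → Surjective v
surjective-from-top v cn top d with below-top d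
... | inj₁ refl = top
... | inj₂ d<top = occurs-below v cn top d<top

canonical-∷ʳ⁻ : ∀ {N k} (v : Vec (Fin k) N) c → Canonical (v ∷ʳ c) → Canonical v
canonical-∷ʳ⁻ v c cn i d d<vi
  with cn (inject₁ i) d (subst (λ z → toℕ d < toℕ z) (sym (lookup-∷ʳ-earlier v c i)) d<vi)
... | j , j<i , e with lastView j
...   | earlier j′ = j′ , subst₂ _<_ (toℕ-inject₁ j′) (toℕ-inject₁ i) j<i , trans (sym (lookup-∷ʳ-earlier v c j′)) e
...   | final      = ⊥-elim (<-asym j<i (earlier<final i))

canonical-∷ʳ-new : ∀ {N k} (v : Vec (Fin k) N) c → Canonical (v ∷ʳ c) → ∀ d → toℕ d < toℕ c → Occurs v d
canonical-∷ʳ-new {N} v c cn d d<c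
  with cn (fromℕ N) d (subst (λ z → toℕ d < toℕ z) (sym (lookup-∷ʳ-final v c)) d<c)
... | j , j<last , e with lastView j
...   | earlier j′ = j′ , trans (sym (lookup-∷ʳ-earlier v c j′)) e
...   | final      = ⊥-elim (<-irrefl refl j<last)

canonical-∷ʳ⁺ : ∀ {N k} (v : Vec (Fin k) N) c → Canonical v → (∀ d → toℕ d < toℕ c → Occurs v d) → Canonical (v ∷ʳ c)
canonical-∷ʳ⁺ {N} v c cn new x d d<vx with lastView x
... | earlier i =
  let j , j<i , e = cn i d (subst (λ z → toℕ d < toℕ z) (lookup-∷ʳ-earlier v c i) d<vx)
  in inject₁ j , subst₂ _<_ (sym (toℕ-inject₁ j)) (sym (toℕ-inject₁ i)) j<i , trans (lookup-∷ʳ-earlier v c j) e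
... | final =
  let j , e = new d (subst (λ z → toℕ d < toℕ z) (lookup-∷ʳ-final v c) d<vx)
  in inject₁ j , earlier<final j , trans (lookup-∷ʳ-earlier v c j) e

lookup-lift : ∀ {N k} (w : Vec (Fin k) N) i → lookup (Vec.map inject₁ w) i ≡ inject₁ (lookup w i)
lookup-lift w i = lookup-map i inject₁ w

toℕ-lookup-lift : ∀ {N k} (w : Vec (Fin k) N) i → toℕ (lookup (Vec.map inject₁ w) i) ≡ toℕ (lookup w i)
toℕ-lookup-lift w i = trans (cong toℕ (lookup-lift w i)) (toℕ-inject₁ (lookup w i))

occurs-lift⁺ : ∀ {N k} (w : Vec (Fin k) N) d → Occurs w d → Occurs (Vec.map inject₁ w) (inject₁ d)
occurs-lift⁺ w d (i , e) = i , trans (lookup-lift w i) (cong inject₁ e)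

occurs-lift⁻ : ∀ {N k} (w : Vec (Fin k) N) d → Occurs (Vec.map inject₁ w) (inject₁ d) → Occurs w d
occurs-lift⁻ w d (i , e) = i , inject₁-injective (trans (sym (lookup-lift w i)) e)

lift-misses-top : ∀ {N k} (w : Vec (Fin k) N) → ¬ Occurs (Vec.map inject₁ w) (fromℕ k)
lift-misses-top w (i , e) = fromℕ≢inject₁ (sym (trans (sym (lookup-lift w i)) e))

canonical-lift⁺ : ∀ {N k} (w : Vec (Fin k) N) → Canonical w → Canonical (Vec.map inject₁ w)
canonical-lift⁺ {k = k} w cn i d d<wi with lastView d
... | earlier d′ =
  let j , j<i , e = cn i d′ (subst₂ _<_ (toℕ-inject₁ d′) (toℕ-lookup-lift w i) d<wi)
  in j , j<i , trans (lookup-lift w j) (cong inject₁ e)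
... | final = ⊥-elim (<-asym (subst (toℕ (fromℕ k) <_) (toℕ-lookup-lift w i) d<wi)
                             (subst (toℕ (lookup w i) <_) (sym (toℕ-fromℕ k)) (toℕ<n (lookup w i))))

canonical-lift⁻ : ∀ {N k} (w : Vec (Fin k) N) → Canonical (Vec.map inject₁ w) → Canonical w
canonical-lift⁻ w cn i d d<wi =
  let j , j<i , e = cn i (inject₁ d) (subst₂ _<_ (sym (toℕ-inject₁ d)) (sym (toℕ-lookup-lift w i)) d<wi)
  in j , j<i , inject₁-injective (trans (sym (lookup-lift w j)) e)

∷ʳ-partition : ∀ {N k} (v : Vec (Fin k) N) c → IsPartition v → IsPartition (v ∷ʳ c)
∷ʳ-partition v c (s , cn) = (λ d → occurs-∷ʳ⁺ v c d (s d)) , canonical-∷ʳ⁺ v c cn (λ d _ → s d)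

∷ʳ-new-block : ∀ {N k} (v : Vec (Fin (suc k)) N) c → IsPartition (v ∷ʳ c) → ¬ IsPartition v → c ≡ fromℕ k
∷ʳ-new-block {k = k} v c (s , cn) ¬part with occurs-∷ʳ⁻ v c (fromℕ k) (s (fromℕ k))
... | inj₂ c≡top = c≡top
... | inj₁ top   = ⊥-elim (¬part (surjective-from-top v cv top , cv))
  where cv = canonical-∷ʳ⁻ v c cn

∷ʳ-top-partition : ∀ {N k} (v : Vec (Fin (suc k)) N) → Occurs v (fromℕ k) →
  IsPartition (v ∷ʳ fromℕ k) → IsPartition v
∷ʳ-top-partition {k = k} v top (_ , cn) = surjective-from-top v cv top , cv
  where cv = canonical-∷ʳ⁻ v (fromℕ k) cn

lift-not-partition : ∀ {N k} (w : Vec (Fin k) N) → ¬ IsPartition (Vec.map inject₁ w)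
lift-not-partition {k = k} w (s , _) = lift-misses-top w (s (fromℕ k))

lift-∷ʳ-top⇔ : ∀ {N k} (w : Vec (Fin k) N) → IsPartition (Vec.map inject₁ w ∷ʳ fromℕ k) ⇔ IsPartition w
lift-∷ʳ-top⇔ {k = k} w = mk⇔ to from
  where
  u = Vec.map inject₁ w
  to : IsPartition (u ∷ʳ fromℕ k) → IsPartition w
  to (_ , cn) = (λ d → occurs-lift⁻ w d (canonical-∷ʳ-new u (fromℕ k) cn (inject₁ d) (earlier<final d)))
              , canonical-lift⁻ w (canonical-∷ʳ⁻ u (fromℕ k) cn)
  from : IsPartition w → IsPartition (u ∷ʳ fromℕ k)
  from (s , cn) = surj , canonical-∷ʳ⁺ u (fromℕ k) (canonical-lift⁺ w cn) below
    where
    below : ∀ d → toℕ d < toℕ (fromℕ k) → Occurs u d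
    below d d<top with lastView d
    ... | earlier d′ = occurs-lift⁺ w d′ (s d′)
    ... | final      = ⊥-elim (<-irrefl refl d<top)
    surj : Surjective (u ∷ʳ fromℕ k)
    surj d with below-top d
    ... | inj₁ refl  = occurs-∷ʳ-final u (fromℕ k)
    ... | inj₂ d<top = occurs-∷ʳ⁺ u (fromℕ k) d (below d d<top)

isPartitionᵇ-true : ∀ {N k} (v : Vec (Fin k) N) → IsPartition v → isPartitionᵇ v ≡ true
isPartitionᵇ-true v part = Equivalence.to T-≡ (Equivalence.from (isPartitionᵇ⇔ v) part)

isPartitionᵇ-false : ∀ {N k} (v : Vec (Fin k) N) → ¬ IsPartition v → isPartitionᵇ v ≡ false
isPartitionᵇ-false v ¬part =
  Equivalence.to T-not-≡ (T-not⁻ (¬part ∘ Equivalence.to (isPartitionᵇ⇔ v)))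

isPartitionᵇ-⇔ : ∀ {N N′ k k′} (u : Vec (Fin k) N) (v : Vec (Fin k′) N′) →
  IsPartition u ⇔ IsPartition v → isPartitionᵇ u ≡ isPartitionᵇ v
isPartitionᵇ-⇔ u v u⇔v =
  T-ext (Equivalence.from (isPartitionᵇ⇔ v) ∘ Equivalence.to u⇔v ∘ Equivalence.to (isPartitionᵇ⇔ u))
        (Equivalence.from (isPartitionᵇ⇔ u) ∘ Equivalence.from u⇔v ∘ Equivalence.to (isPartitionᵇ⇔ v))

𝟙-∧-falseˡ : ∀ {a} b → a ≡ false → 𝟙 (a ∧ b) ≡ 0
𝟙-∧-falseˡ b refl = refl

𝟙-∧-falseʳ : ∀ a {b} → b ≡ false → 𝟙 (a ∧ b) ≡ 0
𝟙-∧-falseʳ a refl = cong 𝟙 (∧-zeroʳ a)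

-- For a fixed prefix v: if v is a partition, the last point may join any of
-- the k+1 blocks; otherwise it must open the top block.
last-point-choices : ∀ N k (X : Vec (Fin (suc k)) (suc N) → Bool) (v : Vec (Fin (suc k)) N) →
  sum {suc k} (λ c → 𝟙 (isPartitionᵇ (v ∷ʳ c) ∧ X (v ∷ʳ c)))
    ≡ 𝟙 (isPartitionᵇ v) * sum {suc k} (λ c → 𝟙 (X (v ∷ʳ c)))
      + 𝟙 (not (isPartitionᵇ v) ∧ (isPartitionᵇ (v ∷ʳ fromℕ k) ∧ X (v ∷ʳ fromℕ k)))
last-point-choices N k X v with isPartitionᵇ v in eq
... | true = begin
  sum {suc k} (λ c → 𝟙 (isPartitionᵇ (v ∷ʳ c) ∧ X (v ∷ʳ c)))
    ≡⟨ sum-cong-≗ {suc k} (λ c → cong (λ b → 𝟙 (b ∧ X (v ∷ʳ c))) (isPartitionᵇ-true (v ∷ʳ c) (∷ʳ-partition v c part))) ⟩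
  sum {suc k} (λ c → 𝟙 (X (v ∷ʳ c)))
    ≡⟨ sym (trans (+-identityʳ _) (+-identityʳ (sum {suc k} (λ c → 𝟙 (X (v ∷ʳ c)))))) ⟩
  1 * sum {suc k} (λ c → 𝟙 (X (v ∷ʳ c))) + 0 ∎
  where part = Equivalence.to (isPartitionᵇ⇔ v) (subst T (sym eq) _)
... | false = begin
  sum {suc k} (λ c → 𝟙 (isPartitionᵇ (v ∷ʳ c) ∧ X (v ∷ʳ c)))
    ≡⟨ sum-init-last {k} (λ c → 𝟙 (isPartitionᵇ (v ∷ʳ c) ∧ X (v ∷ʳ c))) ⟩
  sum {k} (λ c → 𝟙 (isPartitionᵇ (v ∷ʳ inject₁ c) ∧ X (v ∷ʳ inject₁ c))) + top-term
    ≡⟨ cong (_+ top-term) (sum-zero k (λ c → 𝟙-∧-falseˡ (X (v ∷ʳ inject₁ c)) (isPartitionᵇ-false (v ∷ʳ inject₁ c) (not-top c)))) ⟩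
  top-term ∎
  where
  top-term = 𝟙 (isPartitionᵇ (v ∷ʳ fromℕ k) ∧ X (v ∷ʳ fromℕ k))
  ¬part : ¬ IsPartition v
  ¬part p = subst T eq (Equivalence.from (isPartitionᵇ⇔ v) p)
  not-top : ∀ c → ¬ IsPartition (v ∷ʳ inject₁ c)
  not-top c part = fromℕ≢inject₁ (sym (∷ʳ-new-block v (inject₁ c) part ¬part))

-- Counting partitions of N+1 points into k+1 blocks satisfying X: either the
-- first N points already form a partition into k+1 blocks and the last point
-- joins one of them, or they form a partition into k blocks and the last point
-- is alone in the top block.
last-point-split : ∀ N k (X : Vec (Fin (suc k)) (suc N) → Bool) →
  sumLab (suc N) (suc k) (λ u → 𝟙 (isPartitionᵇ u ∧ X u))
    ≡ sumLab N (suc k) (λ v → 𝟙 (isPartitionᵇ v) * sum {suc k} (λ c → 𝟙 (X (v ∷ʳ c))))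
      + sumLab N k (λ w → 𝟙 (isPartitionᵇ w ∧ X (Vec.map inject₁ w ∷ʳ fromℕ k)))
last-point-split N k X = begin
  sumLab (suc N) (suc k) (λ u → 𝟙 (isPartitionᵇ u ∧ X u))
    ≡⟨ sumLab-snoc N (suc k) (λ u → 𝟙 (isPartitionᵇ u ∧ X u)) ⟩
  sumLab N (suc k) (λ v → sum {suc k} (λ c → 𝟙 (isPartitionᵇ (v ∷ʳ c) ∧ X (v ∷ʳ c))))
    ≡⟨ sumLab-cong N (suc k) (last-point-choices N k X) ⟩
  sumLab N (suc k) (λ v → joins v + opens v)
    ≡⟨ sumLab-+ N (suc k) joins opens ⟩
  sumLab N (suc k) joins + sumLab N (suc k) opens
    ≡⟨ cong (sumLab N (suc k) joins +_) (sumLab-lift N k opens opens-top≡0) ⟩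
  sumLab N (suc k) joins + sumLab N k (opens ∘ Vec.map inject₁)
    ≡⟨ cong (sumLab N (suc k) joins +_) (sumLab-cong N k opens-lift) ⟩
  sumLab N (suc k) joins + sumLab N k (λ w → 𝟙 (isPartitionᵇ w ∧ X (Vec.map inject₁ w ∷ʳ fromℕ k))) ∎
  where
  joins opens : Vec (Fin (suc k)) N → ℕ
  joins v = 𝟙 (isPartitionᵇ v) * sum {suc k} (λ c → 𝟙 (X (v ∷ʳ c)))
  opens v = 𝟙 (not (isPartitionᵇ v) ∧ (isPartitionᵇ (v ∷ʳ fromℕ k) ∧ X (v ∷ʳ fromℕ k)))
  -- a prefix using the top label cannot be completed by opening the top block
  opens-top≡0 : ∀ v i → lookup v i ≡ fromℕ k → opens v ≡ 0
  opens-top≡0 v i v-top with isPartitionᵇ v in eq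
  ... | true  = refl
  ... | false = 𝟙-∧-falseˡ (X (v ∷ʳ fromℕ k)) (isPartitionᵇ-false (v ∷ʳ fromℕ k) λ part →
                  subst T eq (Equivalence.from (isPartitionᵇ⇔ v) (∷ʳ-top-partition v (i , v-top) part)))
  opens-lift : ∀ w → opens (Vec.map inject₁ w) ≡ 𝟙 (isPartitionᵇ w ∧ X (Vec.map inject₁ w ∷ʳ fromℕ k))
  opens-lift w rewrite isPartitionᵇ-false (Vec.map inject₁ w) (lift-not-partition w)
                     | isPartitionᵇ-⇔ (Vec.map inject₁ w ∷ʳ fromℕ k) w (lift-∷ʳ-top⇔ w) = refl

-- Partitions separating a conflict relation

-- Points a, b with A a b must lie in different blocks.  The r-Stirling and
-- K(r₁,…,r_p)-Stirling conditions of Defs are both of this form.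
separatesᵇ : (ℕ → ℕ → Bool) → ∀ {N k} → Vec (Fin k) N → Bool
separatesᵇ A {N} f =
  all (λ x → all (λ y → not (A (toℕ x) (toℕ y)) ∨ not (lookup f x =ᶠ lookup f y)) (allFin N)) (allFin N)

Separates : (ℕ → ℕ → Bool) → ∀ {N k} → Vec (Fin k) N → Set
Separates A {N} f = (x y : Fin N) → T (A (toℕ x) (toℕ y)) → lookup f x ≢ lookup f y

separatesᵇ⇔ : ∀ A {N k} (f : Vec (Fin k) N) → T (separatesᵇ A f) ⇔ Separates A f
separatesᵇ⇔ A f = mk⇔
  (λ t x y a e → T-not⁺ (implies⁺ (all-allFin⁺ _ (all-allFin⁺ _ t x) y) a) (≡⇒=ᶠ e))
  (λ sep → all-allFin⁻ _ (λ x → all-allFin⁻ _ (λ y → implies⁻ (λ a → T-not⁻ (sep x y a ∘ =ᶠ⇒≡)))))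

separatesᵇ-⇔ : ∀ A B {N N′ k k′} (u : Vec (Fin k) N) (v : Vec (Fin k′) N′) →
  Separates A u ⇔ Separates B v → separatesᵇ A u ≡ separatesᵇ B v
separatesᵇ-⇔ A B u v u⇔v =
  T-ext (Equivalence.from (separatesᵇ⇔ B v) ∘ Equivalence.to u⇔v ∘ Equivalence.to (separatesᵇ⇔ A u))
        (Equivalence.from (separatesᵇ⇔ A u) ∘ Equivalence.from u⇔v ∘ Equivalence.to (separatesᵇ⇔ B v))

avoiding : (ℕ → ℕ → Bool) → ℕ → ℕ → ℕ
avoiding A m k = countPartitions m k (separatesᵇ A)

ConflictsBelow : (ℕ → ℕ → Bool) → ℕ → Set
ConflictsBelow A t = ∀ a b → T (A a b) → a < t × b < t

-- Points from t on are unconstrained, so appending one cannot create a conflict.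
separates-∷ʳ : ∀ A t → ConflictsBelow A t → ∀ {N k} → t ≤ N → (v : Vec (Fin k) N) (c : Fin k) →
  Separates A (v ∷ʳ c) ⇔ Separates A v
separates-∷ʳ A t below {N} t≤N v c = mk⇔ to from
  where
  to : Separates A (v ∷ʳ c) → Separates A v
  to sep x y a e =
    sep (inject₁ x) (inject₁ y) (subst₂ (λ m n → T (A m n)) (sym (toℕ-inject₁ x)) (sym (toℕ-inject₁ y)) a)
        (trans (lookup-∷ʳ-earlier v c x) (trans e (sym (lookup-∷ʳ-earlier v c y))))
  unconstrained : ∀ {a} → a < t → a ≢ toℕ (fromℕ N)
  unconstrained a<t refl = <⇒≱ a<t (subst (t ≤_) (sym (toℕ-fromℕ N)) t≤N)
  from : Separates A v → Separates A (v ∷ʳ c)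
  from sep x y a e with lastView x | lastView y
  ... | final | _ = unconstrained (proj₁ (below _ _ a)) refl
  ... | earlier _ | final = unconstrained (proj₂ (below _ _ a)) refl
  ... | earlier x′ | earlier y′ =
    sep x′ y′ (subst₂ (λ m n → T (A m n)) (toℕ-inject₁ x′) (toℕ-inject₁ y′) a)
        (trans (sym (lookup-∷ʳ-earlier v c x′)) (trans e (lookup-∷ʳ-earlier v c y′)))

separates-lift : ∀ A {N k} (w : Vec (Fin k) N) → Separates A (Vec.map inject₁ w) ⇔ Separates A w
separates-lift A w = mk⇔
  (λ sep x y a e → sep x y a (trans (lookup-lift w x) (trans (cong inject₁ e) (sym (lookup-lift w y)))))
  (λ sep x y a e → sep x y a (inject₁-injective (trans (sym (lookup-lift w x)) (trans e (lookup-lift w y)))))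

𝟙-∧-* : ∀ a b n → 𝟙 a * (n * 𝟙 b) ≡ n * 𝟙 (a ∧ b)
𝟙-∧-* false b n = sym (*-zeroʳ n)
𝟙-∧-* true  b n = +-identityʳ _

-- The triangular recurrence: the last point joins one of the k+1 blocks of a
-- partition of the first m points, or is alone.
avoiding-recurrence : ∀ A t → ConflictsBelow A t → ∀ m k → t ≤ m →
  avoiding A (suc m) (suc k) ≡ suc k * avoiding A m (suc k) + avoiding A m k
avoiding-recurrence A t below m k t≤m = begin
  avoiding A (suc m) (suc k)
    ≡⟨ countPartitions≡sumLab (suc m) (suc k) (separatesᵇ A) ⟩
  sumLab (suc m) (suc k) (λ u → 𝟙 (isPartitionᵇ u ∧ separatesᵇ A u))
    ≡⟨ last-point-split m k (separatesᵇ A) ⟩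
  sumLab m (suc k) (λ v → 𝟙 (isPartitionᵇ v) * sum {suc k} (λ c → 𝟙 (separatesᵇ A (v ∷ʳ c))))
    + sumLab m k (λ w → 𝟙 (isPartitionᵇ w ∧ separatesᵇ A (Vec.map inject₁ w ∷ʳ fromℕ k)))
    ≡⟨ cong₂ _+_ (sumLab-cong m (suc k) joins) (sumLab-cong m k opens) ⟩
  sumLab m (suc k) (λ v → suc k * 𝟙 (isPartitionᵇ v ∧ separatesᵇ A v))
    + sumLab m k (λ w → 𝟙 (isPartitionᵇ w ∧ separatesᵇ A w))
    ≡⟨ cong (_+ sumLab m k (λ w → 𝟙 (isPartitionᵇ w ∧ separatesᵇ A w)))
            (sumLab-* m (suc k) (suc k) (λ v → 𝟙 (isPartitionᵇ v ∧ separatesᵇ A v))) ⟩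
  suc k * sumLab m (suc k) (λ v → 𝟙 (isPartitionᵇ v ∧ separatesᵇ A v))
    + sumLab m k (λ w → 𝟙 (isPartitionᵇ w ∧ separatesᵇ A w))
    ≡⟨ sym (cong₂ _+_ (cong (suc k *_) (countPartitions≡sumLab m (suc k) (separatesᵇ A)))
                      (countPartitions≡sumLab m k (separatesᵇ A))) ⟩
  suc k * avoiding A m (suc k) + avoiding A m k ∎
  where
  sep-∷ʳ : ∀ {k} (v : Vec (Fin k) m) c → separatesᵇ A (v ∷ʳ c) ≡ separatesᵇ A v
  sep-∷ʳ v c = separatesᵇ-⇔ A A (v ∷ʳ c) v (separates-∷ʳ A t below t≤m v c)
  joins : ∀ v → 𝟙 (isPartitionᵇ v) * sum {suc k} (λ c → 𝟙 (separatesᵇ A (v ∷ʳ c)))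
              ≡ suc k * 𝟙 (isPartitionᵇ v ∧ separatesᵇ A v)
  joins v = begin
    𝟙 (isPartitionᵇ v) * sum {suc k} (λ c → 𝟙 (separatesᵇ A (v ∷ʳ c)))
      ≡⟨ cong (𝟙 (isPartitionᵇ v) *_) (trans (sum-cong-≗ {suc k} (cong 𝟙 ∘ sep-∷ʳ v)) (sum-const (suc k) _)) ⟩
    𝟙 (isPartitionᵇ v) * (suc k * 𝟙 (separatesᵇ A v))
      ≡⟨ 𝟙-∧-* (isPartitionᵇ v) (separatesᵇ A v) (suc k) ⟩
    suc k * 𝟙 (isPartitionᵇ v ∧ separatesᵇ A v) ∎
  opens : ∀ w → 𝟙 (isPartitionᵇ w ∧ separatesᵇ A (Vec.map inject₁ w ∷ʳ fromℕ k))
              ≡ 𝟙 (isPartitionᵇ w ∧ separatesᵇ A w)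
  opens w = cong (λ b → 𝟙 (isPartitionᵇ w ∧ b))
    (trans (sep-∷ʳ (Vec.map inject₁ w) (fromℕ k))
           (separatesᵇ-⇔ A A (Vec.map inject₁ w) w (separates-lift A w)))

avoiding-no-blocks : ∀ A m → avoiding A (suc m) 0 ≡ 0
avoiding-no-blocks A m =
  trans (countPartitions≡sumLab (suc m) 0 (separatesᵇ A)) (sumLab-zero m 0 _ (λ _ → refl))

-- Summation by parts for the triangular recurrence

recurrence-by-parts : ∀ n (a f g : ℕ → ℕ) → g 0 ≡ 0 → (∀ j → g (suc j) ≡ suc j * f (suc j) + f j) →
  a (suc n) ≡ 0 → σ (suc n) (λ j → a j * g j) ≡ σ (suc n) (λ j → (j * a j + a (suc j)) * f j)
recurrence-by-parts n a f g g0≡0 g-step a-end≡0 = begin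
  a 0 * g 0 + σ n (λ j → a (suc j) * g (suc j))
    ≡⟨ cong₂ _+_ (trans (cong (a 0 *_) g0≡0) (*-zeroʳ (a 0))) (σ-cong n expand) ⟩
  σ n (λ j → suc j * a (suc j) * f (suc j) + a (suc j) * f j)
    ≡⟨ σ-+ n (λ j → suc j * a (suc j) * f (suc j)) (λ j → a (suc j) * f j) ⟩
  σ (suc n) (λ j → j * a j * f j) + σ n (λ j → a (suc j) * f j)
    ≡⟨ cong (σ (suc n) (λ j → j * a j * f j) +_) extend ⟩
  σ (suc n) (λ j → j * a j * f j) + σ (suc n) (λ j → a (suc j) * f j)
    ≡⟨ σ-+ (suc n) (λ j → j * a j * f j) (λ j → a (suc j) * f j) ⟨
  σ (suc n) (λ j → j * a j * f j + a (suc j) * f j)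
    ≡⟨ σ-cong (suc n) (λ j → sym (*-distribʳ-+ (f j) (j * a j) (a (suc j)))) ⟩
  σ (suc n) (λ j → (j * a j + a (suc j)) * f j) ∎
  where
  open +-*-Solver
  expand : ∀ j → a (suc j) * g (suc j) ≡ suc j * a (suc j) * f (suc j) + a (suc j) * f j
  expand j = begin
    a (suc j) * g (suc j)                                 ≡⟨ cong (a (suc j) *_) (g-step j) ⟩
    a (suc j) * (suc j * f (suc j) + f j)                 ≡⟨ solve 4 (λ a j′ f′ f → a :* (j′ :* f′ :+ f) := j′ :* a :* f′ :+ a :* f)
                                                               refl (a (suc j)) (suc j) (f (suc j)) (f j) ⟩
    suc j * a (suc j) * f (suc j) + a (suc j) * f j       ∎
  -- the extra term a (n+1) · f n vanishes
  extend : σ n (λ j → a (suc j) * f j) ≡ σ (suc n) (λ j → a (suc j) * f j)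
  extend = begin
    σ n (λ j → a (suc j) * f j)                     ≡⟨ +-identityʳ _ ⟨
    σ n (λ j → a (suc j) * f j) + 0                 ≡⟨ cong (σ n (λ j → a (suc j) * f j) +_) (cong (_* f n) a-end≡0) ⟨
    σ n (λ j → a (suc j) * f j) + a (suc n) * f n   ≡⟨ σ-last n (λ j → a (suc j) * f j) ⟨
    σ (suc n) (λ j → a (suc j) * f j)               ∎

-- r-Stirling numbers

distinctBelow : ℕ → ℕ → ℕ → Bool
distinctBelow r a b = (a <ᵇ r) ∧ (b <ᵇ r) ∧ not (a ≡ᵇ b)

distinctBelow⇔ : ∀ r a b → T (distinctBelow r a b) ⇔ (a < r × b < r × a ≢ b)
distinctBelow⇔ r a b = mk⇔
  (λ t → let a<r , rest = Equivalence.to T-∧ t ; b<r , a≢b = Equivalence.to (T-∧ {b <ᵇ r}) rest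
         in <ᵇ⇒< a r a<r , <ᵇ⇒< b r b<r , T-not⁺ a≢b ∘ ≡⇒≡ᵇ a b)
  (λ (a<r , b<r , a≢b) → Equivalence.from T-∧ (<⇒<ᵇ a<r , Equivalence.from T-∧ (<⇒<ᵇ b<r , T-not⁻ (a≢b ∘ ≡ᵇ⇒≡ a b))))

distinctBelow-below : ∀ r → ConflictsBelow (distinctBelow r) r
distinctBelow-below r a b t = let a<r , b<r , _ = Equivalence.to (distinctBelow⇔ r a b) t in a<r , b<r

-- rS m k r counts partitions of m points into k blocks with 0,…,r-1 in
-- distinct blocks; it is the r-Stirling number once r ≤ m.
rS : ℕ → ℕ → ℕ → ℕ
rS m k r = avoiding (distinctBelow r) m k

<ᵇ-false : ∀ {m r} → r ≤ m → (m <ᵇ r) ≡ false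
<ᵇ-false {m} {r} r≤m = Equivalence.to T-not-≡ (T-not⁻ (λ t → <⇒≱ (<ᵇ⇒< m r t) r≤m))

rStirling≡rS : ∀ m k r → r ≤ m → rStirling m k r ≡ rS m k r
rStirling≡rS m k r r≤m rewrite <ᵇ-false r≤m = refl

rS-recurrence : ∀ m k r → r ≤ m → rS (suc m) (suc k) r ≡ suc k * rS m (suc k) r + rS m k r
rS-recurrence m k r = avoiding-recurrence (distinctBelow r) r (distinctBelow-below r) m k

rS-no-blocks : ∀ m r → rS (suc m) 0 r ≡ 0
rS-no-blocks m r = avoiding-no-blocks (distinctBelow r) m

distinctBelow-inject₁ : ∀ {N} (x y : Fin N) →
  T (distinctBelow (suc N) (toℕ (inject₁ x)) (toℕ (inject₁ y))) ⇔ T (distinctBelow N (toℕ x) (toℕ y))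
distinctBelow-inject₁ {N} x y = mk⇔
  (λ t → let _ , _ , x≢y = Equivalence.to (distinctBelow⇔ (suc N) _ _) t
         in Equivalence.from (distinctBelow⇔ N _ _)
              (toℕ<n x , toℕ<n y , λ e → x≢y (trans (toℕ-inject₁ x) (trans e (sym (toℕ-inject₁ y))))))
  (λ t → let x<N , y<N , x≢y = Equivalence.to (distinctBelow⇔ N _ _) t
         in Equivalence.from (distinctBelow⇔ (suc N) _ _)
              (subst (_< suc N) (sym (toℕ-inject₁ x)) (m<n⇒m<1+n x<N) ,
               subst (_< suc N) (sym (toℕ-inject₁ y)) (m<n⇒m<1+n y<N) ,
               λ e → x≢y (trans (sym (toℕ-inject₁ x)) (trans e (toℕ-inject₁ y)))))

separates-distinct-top : ∀ {N k} (w : Vec (Fin k) N) →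
  Separates (distinctBelow (suc N)) (Vec.map inject₁ w ∷ʳ fromℕ k) ⇔ Separates (distinctBelow N) w
separates-distinct-top {N} {k} w = mk⇔ to from
  where
  u = Vec.map inject₁ w ∷ʳ fromℕ k
  lookup-u : ∀ x → lookup u (inject₁ x) ≡ inject₁ (lookup w x)
  lookup-u x = trans (lookup-∷ʳ-earlier (Vec.map inject₁ w) (fromℕ k) x) (lookup-lift w x)
  lookup-u-final : lookup u (fromℕ N) ≡ fromℕ k
  lookup-u-final = lookup-∷ʳ-final (Vec.map inject₁ w) (fromℕ k)
  to : Separates (distinctBelow (suc N)) u → Separates (distinctBelow N) w
  to sep x y a e = sep (inject₁ x) (inject₁ y) (Equivalence.from (distinctBelow-inject₁ x y) a)
                       (trans (lookup-u x) (trans (cong inject₁ e) (sym (lookup-u y))))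
  from : Separates (distinctBelow N) w → Separates (distinctBelow (suc N)) u
  from sep x y a e with lastView x | lastView y
  ... | final | final = proj₂ (proj₂ (Equivalence.to (distinctBelow⇔ (suc N) (toℕ (fromℕ N)) _) a)) refl
  ... | earlier x′ | final = fromℕ≢inject₁ (sym (trans (sym (lookup-u x′)) (trans e lookup-u-final)))
  ... | final | earlier y′ = fromℕ≢inject₁ (trans (sym lookup-u-final) (trans e (lookup-u y′)))
  ... | earlier x′ | earlier y′ = sep x′ y′ (Equivalence.to (distinctBelow-inject₁ x′ y′) a)
                                    (inject₁-injective (trans (sym (lookup-u x′)) (trans e (lookup-u y′))))

-- Appending a point to a partition of N points into distinct singletons:
-- the new point conflicts with every block, so it must open a new one.
rS-diagonal-step : ∀ N k → rS (suc N) (suc k) (suc N) ≡ rS N k N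
rS-diagonal-step N k = begin
  rS (suc N) (suc k) (suc N)
    ≡⟨ countPartitions≡sumLab (suc N) (suc k) (separatesᵇ A) ⟩
  sumLab (suc N) (suc k) (λ u → 𝟙 (isPartitionᵇ u ∧ separatesᵇ A u))
    ≡⟨ last-point-split N k (separatesᵇ A) ⟩
  sumLab N (suc k) (λ v → 𝟙 (isPartitionᵇ v) * sum {suc k} (λ c → 𝟙 (separatesᵇ A (v ∷ʳ c))))
    + sumLab N k (λ w → 𝟙 (isPartitionᵇ w ∧ separatesᵇ A (Vec.map inject₁ w ∷ʳ fromℕ k)))
    ≡⟨ cong₂ _+_ (sumLab-zero N (suc k) _ no-join) (sumLab-cong N k opens) ⟩
  sumLab N k (λ w → 𝟙 (isPartitionᵇ w ∧ separatesᵇ (distinctBelow N) w))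
    ≡⟨ countPartitions≡sumLab N k (separatesᵇ (distinctBelow N)) ⟨
  rS N k N ∎
  where
  A = distinctBelow (suc N)
  -- if v is a partition, the block of the new point already contains an earlier point
  no-join : ∀ v → 𝟙 (isPartitionᵇ v) * sum {suc k} (λ c → 𝟙 (separatesᵇ A (v ∷ʳ c))) ≡ 0
  no-join v with isPartitionᵇ v in eq
  ... | false = refl
  ... | true  = trans (+-identityʳ _) (sum-zero (suc k) (λ c → cong 𝟙 (Equivalence.to T-not-≡ (T-not⁻ (collides c)))))
    where
    collides : ∀ c → ¬ T (separatesᵇ A (v ∷ʳ c))
    collides c t =
      let i , vi≡c = proj₁ (Equivalence.to (isPartitionᵇ⇔ v) (subst T (sym eq) _)) c
          i<N = inject₁ℕ< i
          last≡N = toℕ-fromℕ N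
      in Equivalence.to (separatesᵇ⇔ A (v ∷ʳ c)) t (inject₁ i) (fromℕ N)
           (Equivalence.from (distinctBelow⇔ (suc N) _ _)
             (m<n⇒m<1+n i<N , subst (_< suc N) (sym last≡N) ≤-refl , λ e → <-irrefl (trans e last≡N) i<N))
           (trans (lookup-∷ʳ-earlier v c i) (trans vi≡c (sym (lookup-∷ʳ-final v c))))
  opens : ∀ w → 𝟙 (isPartitionᵇ w ∧ separatesᵇ A (Vec.map inject₁ w ∷ʳ fromℕ k))
              ≡ 𝟙 (isPartitionᵇ w ∧ separatesᵇ (distinctBelow N) w)
  opens w = cong (λ b → 𝟙 (isPartitionᵇ w ∧ b))
    (separatesᵇ-⇔ A (distinctBelow N) (Vec.map inject₁ w ∷ʳ fromℕ k) w (separates-distinct-top w))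

rS-diagonal : ∀ N k → rS N k N ≡ 𝟙 (N ≡ᵇ k)
rS-diagonal zero    zero    = refl
rS-diagonal zero    (suc k) = refl
rS-diagonal (suc N) zero    = rS-no-blocks N (suc N)
rS-diagonal (suc N) (suc k) = trans (rS-diagonal-step N k) (rS-diagonal N k)

𝟙-≡ᵇ-refl : ∀ n → 𝟙 (n ≡ᵇ n) ≡ 1
𝟙-≡ᵇ-refl zero    = refl
𝟙-≡ᵇ-refl (suc n) = 𝟙-≡ᵇ-refl n

𝟙-≡ᵇ-≢ : ∀ j n → j ≢ n → 𝟙 (j ≡ᵇ n) ≡ 0
𝟙-≡ᵇ-≢ j n j≢n = cong 𝟙 (Equivalence.to T-not-≡ (T-not⁻ (j≢n ∘ ≡ᵇ⇒≡ j n)))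

𝟙-≡ᵇ-* : ∀ j n → n * 𝟙 (j ≡ᵇ n) ≡ j * 𝟙 (j ≡ᵇ n)
𝟙-≡ᵇ-* j n with j ≟ n
... | yes refl = refl
... | no  j≢n  = trans (cong (n *_) (𝟙-≡ᵇ-≢ j n j≢n))
                       (trans (*-zeroʳ n) (sym (trans (cong (j *_) (𝟙-≡ᵇ-≢ j n j≢n)) (*-zeroʳ j))))

rS-vanish : ∀ s j k → k < j → rS (s + j) k j ≡ 0
rS-vanish zero    j k       k<j = trans (rS-diagonal j k) (𝟙-≡ᵇ-≢ j k (λ j≡k → <-irrefl (sym j≡k) k<j))
rS-vanish (suc s) j zero    k<j = rS-no-blocks (s + j) j
rS-vanish (suc s) j (suc k) k<j = begin
  rS (suc (s + j)) (suc k) j                   ≡⟨ rS-recurrence (s + j) k j (m≤n+m j s) ⟩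
  suc k * rS (s + j) (suc k) j + rS (s + j) k j ≡⟨ cong₂ _+_ (cong (suc k *_) (rS-vanish s j (suc k) k<j))
                                                            (rS-vanish s j k (<-trans (n<1+n k) k<j)) ⟩
  suc k * 0 + 0                                ≡⟨ cong (_+ 0) (*-zeroʳ (suc k)) ⟩
  0                                            ∎

-- Splitting on whether the point j shares a block with one of 0,…,j-1:
-- {s+j+1 brace k}_j = j·{s+j brace k}_j + {s+j+1 brace k}_{j+1}.
rS-shift : ∀ s j k → rS (s + suc j) k j ≡ j * rS (s + j) k j + rS (s + suc j) k (suc j)
rS-shift zero j zero = begin
  rS (suc j) 0 j                         ≡⟨ rS-no-blocks j j ⟩
  0 * 𝟙 (j ≡ᵇ 0)                         ≡⟨ 𝟙-≡ᵇ-* j 0 ⟩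
  j * 𝟙 (j ≡ᵇ 0)                         ≡⟨ +-identityʳ _ ⟨
  j * 𝟙 (j ≡ᵇ 0) + 0                     ≡⟨ cong₂ _+_ (cong (j *_) (rS-diagonal j 0)) (rS-no-blocks j (suc j)) ⟨
  j * rS j 0 j + rS (suc j) 0 (suc j)    ∎
rS-shift zero j (suc k) = begin
  rS (suc j) (suc k) j                                  ≡⟨ rS-recurrence j k j ≤-refl ⟩
  suc k * rS j (suc k) j + rS j k j                     ≡⟨ cong₂ _+_ (cong (suc k *_) (rS-diagonal j (suc k))) (rS-diagonal j k) ⟩
  suc k * 𝟙 (j ≡ᵇ suc k) + 𝟙 (j ≡ᵇ k)                  ≡⟨ cong (_+ 𝟙 (j ≡ᵇ k)) (𝟙-≡ᵇ-* j (suc k)) ⟩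
  j * 𝟙 (j ≡ᵇ suc k) + 𝟙 (j ≡ᵇ k)                      ≡⟨ cong₂ _+_ (cong (j *_) (rS-diagonal j (suc k))) (rS-diagonal (suc j) (suc k)) ⟨
  j * rS j (suc k) j + rS (suc j) (suc k) (suc j)       ∎
rS-shift (suc s) j zero =
  trans (rS-no-blocks (s + suc j) j)
        (sym (cong₂ _+_ (trans (cong (j *_) (rS-no-blocks (s + j) j)) (*-zeroʳ j)) (rS-no-blocks (s + suc j) (suc j))))
rS-shift (suc s) j (suc k) = begin
  rS (suc (s + suc j)) (suc k) j
    ≡⟨ rS-recurrence (s + suc j) k j (≤-trans (n≤1+n j) (m≤n+m (suc j) s)) ⟩
  suc k * rS (s + suc j) (suc k) j + rS (s + suc j) k j
    ≡⟨ cong₂ _+_ (cong (suc k *_) (rS-shift s j (suc k))) (rS-shift s j k) ⟩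
  suc k * (j * x + y) + (j * z + w)
    ≡⟨ solve 6 (λ k′ j x y z w → k′ :* (j :* x :+ y) :+ (j :* z :+ w) := j :* (k′ :* x :+ z) :+ (k′ :* y :+ w))
             refl (suc k) j x y z w ⟩
  j * (suc k * x + z) + (suc k * y + w)
    ≡⟨ cong₂ _+_ (cong (j *_) (rS-recurrence (s + j) k j (m≤n+m j s))) (rS-recurrence (s + suc j) k (suc j) (m≤n+m (suc j) s)) ⟨
  j * rS (suc s + j) (suc k) j + rS (suc (s + suc j)) (suc k) (suc j) ∎
  where
  open +-*-Solver
  x = rS (s + j) (suc k) j
  y = rS (s + suc j) (suc k) (suc j)
  z = rS (s + j) k j
  w = rS (s + suc j) k (suc j)

-- The convolution with r-Stirling numbers

record StirlingRecurrence (t : ℕ) (f : ℕ → ℕ → ℕ) : Set where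
  field
    no-blocks  : ∀ m → t ≤ m → f (suc m) 0 ≡ 0
    recurrence : ∀ m k → t ≤ m → f (suc m) (suc k) ≡ suc k * f m (suc k) + f m k

avoiding-stirling : ∀ A t → ConflictsBelow A t → StirlingRecurrence t (avoiding A)
avoiding-stirling A t below = record
  { no-blocks  = λ m _ → avoiding-no-blocks A m
  ; recurrence = avoiding-recurrence A t below
  }

stirling-convolution : ∀ t (f : ℕ → ℕ → ℕ) → StirlingRecurrence t f →
  ∀ s m k → t ≤ m → f (s + m) k ≡ σ (suc k) (λ j → rS (s + j) k j * f m j)
stirling-convolution t f rec zero m k t≤m = sym (begin
  σ (suc k) (λ j → rS j k j * f m j)
    ≡⟨ σ-last k (λ j → rS j k j * f m j) ⟩
  σ k (λ j → rS j k j * f m j) + rS k k k * f m k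
    ≡⟨ cong₂ _+_ (σ-zero k _ (λ j j<k → cong (_* f m j) (trans (rS-diagonal j k) (𝟙-≡ᵇ-≢ j k (<⇒≢ j<k)))))
                 (cong (_* f m k) (trans (rS-diagonal k k) (𝟙-≡ᵇ-refl k))) ⟩
  1 * f m k
    ≡⟨ *-identityˡ (f m k) ⟩
  f m k ∎)
stirling-convolution t f rec (suc s) m k t≤m = begin
  f (suc s + m) k
    ≡⟨ cong (λ n → f n k) (+-suc s m) ⟨
  f (s + suc m) k
    ≡⟨ stirling-convolution t f rec s (suc m) k (m≤n⇒m≤1+n t≤m) ⟩
  σ (suc k) (λ j → a j * f (suc m) j)
    ≡⟨ recurrence-by-parts k a (f m) (f (suc m)) (no-blocks m t≤m) (λ j → recurrence m j t≤m) (rS-vanish s (suc k) k ≤-refl) ⟩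
  σ (suc k) (λ j → (j * a j + a (suc j)) * f m j)
    ≡⟨ σ-cong (suc k) (λ j → cong (_* f m j) (trans (sym (rS-shift s j k)) (cong (λ n → rS n k j) (+-suc s j)))) ⟩
  σ (suc k) (λ j → rS (suc s + j) k j * f m j) ∎
  where
  open StirlingRecurrence rec
  a : ℕ → ℕ
  a j = rS (s + j) k j

-- K(r₁,…,r_p)-Stirling numbers

groupConflict : List ℕ → ℕ → ℕ → Bool
groupConflict L a b = differentGroupsᵇ (groupOf L a) (groupOf L b)

groupOf-outside : ∀ L a → ListSum.sum L ≤ a → groupOf L a ≡ nothing
groupOf-outside []      a _      = refl
groupOf-outside (r ∷ L) a ΣL≤a rewrite <ᵇ-false (≤-trans (m≤m+n r (ListSum.sum L)) ΣL≤a)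
  | groupOf-outside L (a ∸ r) (subst (_≤ a ∸ r) (m+n∸m≡n r (ListSum.sum L)) (∸-monoˡ-≤ r ΣL≤a)) = refl

differentGroupsᵇ-nothingʳ : ∀ x → differentGroupsᵇ x nothing ≡ false
differentGroupsᵇ-nothingʳ (just _) = refl
differentGroupsᵇ-nothingʳ nothing  = refl

groupConflict-below : ∀ L → ConflictsBelow (groupConflict L) (ListSum.sum L)
groupConflict-below L a b t with a <? ListSum.sum L | b <? ListSum.sum L
... | yes a< | yes b< = a< , b<
... | no a≮  | _      = ⊥-elim (subst (λ x → T (differentGroupsᵇ x (groupOf L b))) (groupOf-outside L a (≮⇒≥ a≮)) t)
... | yes _  | no b≮  = ⊥-elim (subst T (trans (cong (differentGroupsᵇ (groupOf L a)) (groupOf-outside L b (≮⇒≥ b≮)))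
                                                (differentGroupsᵇ-nothingʳ (groupOf L a))) t)

KStirling≡avoiding : ∀ {p} (rs : Vec ℕ p) m j → ∣ rs ∣ᵥ ≤ m → KStirling m j rs ≡ avoiding (groupConflict (toList rs)) m j
KStirling≡avoiding rs m j R≤m rewrite <ᵇ-false R≤m = refl

firstOf : ∀ {p} → Vec ℕ p → Fin p → ℕ
firstOf (r ∷ rs) Fin.zero    = 0
firstOf (r ∷ rs) (Fin.suc i) = r + firstOf rs i

firstOf-< : ∀ {p} (rs : Vec ℕ p) → All (1 ≤_) rs → ∀ i → firstOf rs i < ∣ rs ∣ᵥ
firstOf-< (r ∷ rs) (1≤r VecAll.∷ _)  Fin.zero    = ≤-trans 1≤r (m≤m+n r _)
firstOf-< (r ∷ rs) (_ VecAll.∷ 1≤rs) (Fin.suc i) = +-monoʳ-< r (firstOf-< rs 1≤rs i)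

groupOf-firstOf : ∀ {p} (rs : Vec ℕ p) → All (1 ≤_) rs → ∀ i → groupOf (toList rs) (firstOf rs i) ≡ just (toℕ i)
groupOf-firstOf (suc r ∷ rs) _                  Fin.zero    = refl
groupOf-firstOf (r ∷ rs)     (_ VecAll.∷ 1≤rs) (Fin.suc i)
  rewrite <ᵇ-false {r + firstOf rs i} {r} (m≤m+n r _) | m+n∸m≡n r (firstOf rs i) | groupOf-firstOf rs 1≤rs i = refl

-- Since the p nonempty sets R_i are pairwise in conflict, fewer than p
-- blocks are impossible: two of their first points would share a block.
K-vanish : ∀ {p} (rs : Vec ℕ p) → All (1 ≤_) rs → ∀ m j → ∣ rs ∣ᵥ ≤ m → j < p →
  avoiding (groupConflict (toList rs)) m j ≡ 0
K-vanish {p} rs 1≤rs m j R≤m j<p =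
  trans (countPartitions≡sumLab m j (separatesᵇ A))
        (sumLab-zero m j _ (λ f → 𝟙-∧-falseʳ (isPartitionᵇ f) (Equivalence.to T-not-≡ (T-not⁻ (collision f)))))
  where
  A = groupConflict (toList rs)
  first : Fin p → Fin m
  first i = fromℕ< (<-≤-trans (firstOf-< rs 1≤rs i) R≤m)
  group-first : ∀ i → groupOf (toList rs) (toℕ (first i)) ≡ just (toℕ i)
  group-first i = trans (cong (groupOf (toList rs)) (toℕ-fromℕ< _)) (groupOf-firstOf rs 1≤rs i)
  collision : (f : Vec (Fin j) m) → ¬ T (separatesᵇ A f)
  collision f t with pigeonhole j<p (λ i → lookup f (first i))
  ... | i₁ , i₂ , i₁<i₂ , same =
    Equivalence.to (separatesᵇ⇔ A f) t (first i₁) (first i₂) conflict same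
    where
    conflict : T (A (toℕ (first i₁)) (toℕ (first i₂)))
    conflict rewrite group-first i₁ | group-first i₂ = T-not⁻ (λ e → <-irrefl (≡ᵇ⇒≡ (toℕ i₁) (toℕ i₂) e) i₁<i₂)

KStirling-convolution : ∀ {p} (rs : Vec ℕ p) → All (1 ≤_) rs → ∀ n k → p ≤ k → ∣ rs ∣ᵥ ≤ n →
  ∀ s → s ≤ n ∸ ∣ rs ∣ᵥ →
  KStirling n k rs ≡ sumFromTo p k (λ j → rStirling (s + j) k j * KStirling (n ∸ s) j rs)
KStirling-convolution {p} rs 1≤rs n k p≤k R≤n s s≤n∸R = begin
  KStirling n k rs
    ≡⟨ KStirling≡avoiding rs n k R≤n ⟩
  K n k
    ≡⟨ cong (λ n′ → K n′ k) (m+[n∸m]≡n s≤n) ⟨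
  K (s + (n ∸ s)) k
    ≡⟨ stirling-convolution R K (avoiding-stirling A R (groupConflict-below (toList rs))) s (n ∸ s) k R≤n∸s ⟩
  σ (suc k) (λ j → rS (s + j) k j * K (n ∸ s) j)
    ≡⟨ σ-cong (suc k) (λ j → cong₂ _*_ (rStirling≡rS (s + j) k j (m≤n+m j s)) (KStirling≡avoiding rs (n ∸ s) j R≤n∸s)) ⟨
  σ (suc k) (λ j → rStirling (s + j) k j * KStirling (n ∸ s) j rs)
    ≡⟨ sumFromTo≡σ p k _ p≤k few-blocks ⟨
  sumFromTo p k (λ j → rStirling (s + j) k j * KStirling (n ∸ s) j rs) ∎
  where
  R = ∣ rs ∣ᵥ
  A = groupConflict (toList rs)
  K = avoiding A
  s≤n : s ≤ n
  s≤n = ≤-trans s≤n∸R (m∸n≤m n R)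
  R≤n∸s : R ≤ n ∸ s
  R≤n∸s = m+n≤o⇒m≤o∸n R (subst (_≤ n) (+-comm s R) (m≤o∸n⇒m+n≤o s R≤n s≤n∸R))
  few-blocks : ∀ j → j < p → rStirling (s + j) k j * KStirling (n ∸ s) j rs ≡ 0
  few-blocks j j<p = begin
    rStirling (s + j) k j * KStirling (n ∸ s) j rs ≡⟨ cong (rStirling (s + j) k j *_) (KStirling≡avoiding rs (n ∸ s) j R≤n∸s) ⟩
    rStirling (s + j) k j * K (n ∸ s) j           ≡⟨ cong (rStirling (s + j) k j *_) (K-vanish rs 1≤rs (n ∸ s) j R≤n∸s j<p) ⟩
    rStirling (s + j) k j * 0                     ≡⟨ *-zeroʳ (rStirling (s + j) k j) ⟩
    0                                             ∎

KStirling-recurrence : ∀ {p} (rs : Vec ℕ p) n k → 1 ≤ k → ∣ rs ∣ᵥ + 1 ≤ n →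
  KStirling n k rs ≡ k * KStirling (n ∸ 1) k rs + KStirling (n ∸ 1) (k ∸ 1) rs
KStirling-recurrence rs zero k _ R+1≤0 with ≤-trans (m≤n+m 1 ∣ rs ∣ᵥ) R+1≤0
... | ()
KStirling-recurrence rs (suc n) (suc k) _ R+1≤1+n = begin
  KStirling (suc n) (suc k) rs
    ≡⟨ KStirling≡avoiding rs (suc n) (suc k) (m≤n⇒m≤1+n R≤n) ⟩
  K (suc n) (suc k)
    ≡⟨ avoiding-recurrence A R (groupConflict-below (toList rs)) n k R≤n ⟩
  suc k * K n (suc k) + K n k
    ≡⟨ cong₂ _+_ (cong (suc k *_) (KStirling≡avoiding rs n (suc k) R≤n)) (KStirling≡avoiding rs n k R≤n) ⟨
  suc k * KStirling n (suc k) rs + KStirling n k rs ∎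
  where
  R = ∣ rs ∣ᵥ
  A = groupConflict (toList rs)
  K = avoiding A
  R≤n : R ≤ n
  R≤n = s≤s⁻¹ (subst (_≤ suc n) (+-comm R 1) R+1≤1+n)

corollary9 : (p : ℕ) → 2 ≤ p → (rs : Vec ℕ p) → All (1 ≤_) rs →
    (n k : ℕ) → p ≤ k → k ≤ n → ∣ rs ∣ᵥ ≤ n →
    ((s : ℕ) → s ≤ n ∸ ∣ rs ∣ᵥ →
      KStirling n k rs ≡ sumFromTo p k (λ j → rStirling (s + j) k j * KStirling (n ∸ s) j rs))
    × (∣ rs ∣ᵥ + 1 ≤ n →
      KStirling n k rs ≡ k * KStirling (n ∸ 1) k rs + KStirling (n ∸ 1) (k ∸ 1) rs)
    × (KStirling n k rs ≡ sumFromTo p k (λ j → rStirling (n ∸ ∣ rs ∣ᵥ + j) k j * KStirling ∣ rs ∣ᵥ j rs))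
corollary9 p 2≤p rs 1≤rs n k p≤k _ R≤n =
    KStirling-convolution rs 1≤rs n k p≤k R≤n
  , KStirling-recurrence rs n k (≤-trans (≤-trans (s≤s z≤n) 2≤p) p≤k)
  , (begin
      KStirling n k rs
        ≡⟨ KStirling-convolution rs 1≤rs n k p≤k R≤n (n ∸ ∣ rs ∣ᵥ) ≤-refl ⟩
      sumFromTo p k (λ j → rStirling (n ∸ ∣ rs ∣ᵥ + j) k j * KStirling (n ∸ (n ∸ ∣ rs ∣ᵥ)) j rs)
        ≡⟨ cong (λ m → sumFromTo p k (λ j → rStirling (n ∸ ∣ rs ∣ᵥ + j) k j * KStirling m j rs)) (m∸[m∸n]≡n R≤n) ⟩
      sumFromTo p k (λ j → rStirling (n ∸ ∣ rs ∣ᵥ + j) k j * KStirling ∣ rs ∣ᵥ j rs) ∎)
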